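{- Let $G$ be a disconnected finite simple graph on $n\geq 5$ vertices with complement $G^c$, and suppose $h(G^c)=\frac{1}{\lfloor n/2\rfloor}$. If $n$ is even, then $G^c$ is obtained from the disjoint union of a clique on $\frac n2$ vertices and a clique on $\frac n2-1$ vertices by adding one vertex adjacent to all of their vertices. If $n$ is odd, then $G^c$ is obtained from the disjoint union of a clique on $\frac{n-1}{2}$ vertices and a graph $H$ on $\frac{n-1}{2}$ vertices satisfying $\mathrm{vol}_H(V(H))\geq \frac{n-1}{2}\left(\frac{n-1}{2}-3\right)$ by adding one vertex adjacent to all of their vertices.
   Context: For a graph $G=(V,E)$ and $X\subseteq V$ write $\bar X=V\setminus X$ and $\partial_G(X)$ for the set of edges of $G$ with one endpoint in $X$ and the other in $\bar X$. The volume of $X$ is $\mathrm{vol}_G(X)=\sum_{x\in X}\deg_G(x)$ (so $\mathrm{vol}_H(V(H))$ is twice the number of edges of $H$). The Cheeger ratio of a nonempty proper subset $X$ (with positive denominator) is $h_G(X)=\frac{|\partial_G(X)|}{\min\{\mathrm{vol}_G(X),\mathrm{vol}_G(\bar X)\}}$, and the Cheeger constant $h(G)$ is the minimum of $h_G(X)$ over nonempty proper subsets $X$ for which it is defined. The complement $G^c$ has vertex set $V$ and contains exactly the pairs of distinct vertices that are not edges of $G$. -}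

module Defs where

open import Data.Nat using (ℕ; zero; suc; _+_; _*_; _⊔_; _⊓_; _<_)
open import Data.Bool using (Bool; true; false; not; _∧_; if_then_else_)
open import Data.Fin using (Fin; zero; suc; splitAt; _≟_)
open import Data.Sum using (inj₁; inj₂)
open import Data.Product using (Σ; _×_; ∃)
open import Data.Integer using (+_)
open import Data.Rational using (ℚ; _/_; _≤_)
open import Function.Bundles using (_↔_; Inverse)
open import Relation.Nullary using (¬_)
open import Relation.Nullary.Decidable using (⌊_⌋)
open import Relation.Binary.PropositionalEquality using (_≡_)

Adj : ℕ → Set
Adj n = Fin n → Fin n → Bool

record Simple {n : ℕ} (A : Adj n) : Set where
  field
    symm   : ∀ i j → A i j ≡ A j i
    irrefl : ∀ i → A i i ≡ false

complement : ∀ {n} → Adj n → Adj n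
complement A i j = not (A i j) ∧ not ⌊ i ≟ j ⌋

countF : ∀ {n} → (Fin n → Bool) → ℕ
countF {zero} f = 0
countF {suc n} f = (if f zero then 1 else 0) + countF (λ i → f (suc i))

sumF : ∀ {n} → (Fin n → ℕ) → ℕ
sumF {zero} f = 0
sumF {suc n} f = f zero + sumF (λ i → f (suc i))

VSet : ℕ → Set
VSet n = Fin n → Bool

compl : ∀ {n} → VSet n → VSet n
compl X i = not (X i)

full : ∀ {n} → VSet n
full _ = true

deg : ∀ {n} → Adj n → Fin n → ℕ
deg A x = countF (A x)

vol : ∀ {n} → Adj n → VSet n → ℕ
vol A X = sumF (λ x → if X x then deg A x else 0)

-- |∂(X)|: edges with one end in X and the other in the complement
-- (each such edge counted once, as the ordered pair (x ∈ X, y ∉ X))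
boundary : ∀ {n} → Adj n → VSet n → ℕ
boundary A X = sumF (λ x → countF (λ y → X x ∧ not (X y) ∧ A x y))

-- a / d as a rational (only used with d > 0)
ratio : ℕ → ℕ → ℚ
ratio a zero = + 0 / 1
ratio a (suc d) = + a / suc d

cheegerDen : ∀ {n} → Adj n → VSet n → ℕ
cheegerDen A X = vol A X ⊓ vol A (compl X)

cheegerRatio : ∀ {n} → Adj n → VSet n → ℚ
cheegerRatio A X = ratio (boundary A X) (cheegerDen A X)

Admissible : ∀ {n} → Adj n → VSet n → Set
Admissible A X = (∃ λ x → X x ≡ true) × (∃ λ y → X y ≡ false) × (0 < cheegerDen A X)

IsCheegerConstant : ∀ {n} → Adj n → ℚ → Set
IsCheegerConstant A c =
  (∃ λ X → Admissible A X × cheegerRatio A X ≡ c) ×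
  (∀ X → Admissible A X → c ≤ cheegerRatio A X)

data Reachable {n : ℕ} (A : Adj n) : Fin n → Fin n → Set where
  here : ∀ {u} → Reachable A u u
  step : ∀ {u v w} → A u v ≡ true → Reachable A v w → Reachable A u w

Connected : ∀ {n} → Adj n → Set
Connected A = ∀ u v → Reachable A u v

Disconnected : ∀ {n} → Adj n → Set
Disconnected A = ¬ Connected A

Isomorphic : ∀ {n m} → Adj n → Adj m → Set
Isomorphic {n} {m} A B =
  Σ (Fin n ↔ Fin m) λ f → ∀ i j → B (Inverse.to f i) (Inverse.to f j) ≡ A i j

complete : (a : ℕ) → Adj a
complete a i j = not ⌊ i ≟ j ⌋

-- disjoint union (vertices of A first, then those of B)
disjUnion : ∀ {a b} → Adj a → Adj b → Adj (a + b)
disjUnion {a} A B i j with splitAt a i | splitAt a j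
... | inj₁ x | inj₁ y = A x y
... | inj₂ x | inj₂ y = B x y
... | inj₁ _ | inj₂ _ = false
... | inj₂ _ | inj₁ _ = false

cone : ∀ {m} → Adj m → Adj (suc m)
cone A zero zero = false
cone A zero (suc j) = true
cone A (suc i) zero = true
cone A (suc i) (suc j) = A i j

-- Write C = Gᶜ and k = ⌊n/2⌋. A set Y attaining h(C) = 1/k, taken on its smaller side, satisfies
-- k·|∂Y| ≤ vol Y ≤ |Y|(|Y| − 1) + |∂Y|, while |∂Y| ≥ |Y| because G is disconnected; as |Y| ≤ k this
-- forces |Y| = |∂Y| = k, so Y is a clique of C with exactly k boundary edges. C contains every pair
-- across a component S of G, which puts |Y ∩ S|·|Ȳ ∖ S| + |Y ∖ S|·|Ȳ ∩ S| ≤ k edges into ∂Y; for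
-- n ≥ 5 this forces S or its complement to be a single vertex w, adjacent in C to all others. The k
-- boundary edges of a clique side avoiding w are then exactly the edges at w, so C is the cone at w
-- over that clique and the graph H induced on the remaining vertices. For n even the other side is
-- again tight, hence a clique; for n odd, k² ≤ vol Ȳ = 3k + vol H.

module Submission where

open import Defs
open import Data.Nat using (ℕ; zero; suc; pred; _+_; _*_; _∸_; _/_; _%_; _⊓_; _≤_; _<_; _≤?_; z≤n; s≤s)
open import Data.Nat.Properties hiding (_≟_)
open import Data.Nat.DivMod using (m≡m%n+[m/n]*n; m*n/n≡m; /-monoˡ-≤)
open import Data.Nat.Tactic.RingSolver using (solve-∀)
open import Algebra.Properties.CommutativeSemigroup +-commutativeSemigroup using (interchange; x∙yz≈y∙xz)
open import Algebra.Properties.CommutativeMonoid.Sum +-0-commutativeMonoid using (sum; sum-permute)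
open import Data.Bool using (Bool; true; false; not; _∧_; _∨_; if_then_else_)
import Data.Bool.Properties as Bool
open import Data.Fin using (Fin; zero; suc; punchIn; punchOut; _↑ˡ_; _↑ʳ_; splitAt; join)
open import Data.Fin.Properties
  using ( _≟_; any?; punchIn-punchOut; punchInᵢ≢i; splitAt-↑ˡ; splitAt-↑ʳ; join-splitAt; +↔⊎
        ; ↑ˡ-injective; ↑ʳ-injective)
import Data.Fin.Properties as Fin
open import Data.Fin.Permutation using (insert)
import Data.Integer as ℤ
import Data.Integer.Properties as ℤ
open import Data.Rational.Properties using (/-injective-≃)
open import Data.Rational.Unnormalised using (mkℚᵘ; *≡*)
open import Data.Product using (Σ; _×_; _,_; ∃; proj₁; proj₂; map)
open import Data.Sum using (_⊎_; inj₁; inj₂; [_,_]′)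
import Data.Sum as Sum
open import Function using (_∘_; id)
open import Function.Bundles using (_↔_; Inverse; mk↔ₛ′)
open import Function.Properties.Inverse using (↔-sym; ↔-trans)
open import Relation.Nullary using (yes; no; contradiction; _×-dec_)
open import Relation.Nullary.Decidable using (⌊_⌋; does; dec-true)
open import Relation.Binary.PropositionalEquality

private variable
  n m : ℕ

m+n≤m⇒n≡0 : ∀ m {k} → m + k ≤ m → k ≡ 0
m+n≤m⇒n≡0 m {k} le = n≤0⇒n≡0 (+-cancelˡ-≤ m k 0 (≤-trans le (≤-reflexive (sym (+-identityʳ m)))))

k*k≤i+b⇒k*[k∸1]≤i : ∀ k i b → b ≤ k → k * k ≤ i + b → k * (k ∸ 1) ≤ i
k*k≤i+b⇒k*[k∸1]≤i zero    i b _   _ = z≤n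
k*k≤i+b⇒k*[k∸1]≤i (suc j) i b b≤k le = +-cancelʳ-≤ (suc j) _ _ (begin
  suc j * j + suc j  ≡⟨ +-comm (suc j * j) (suc j) ⟩
  suc j + suc j * j  ≡⟨ *-suc (suc j) j ⟨
  suc j * suc j      ≤⟨ le ⟩
  i + b              ≤⟨ +-monoʳ-≤ i b≤k ⟩
  i + suc j          ∎)
  where open ≤-Reasoning

x*y≤x⇒y≤1 : ∀ x y → 1 ≤ x → x * y ≤ x → y ≤ 1
x*y≤x⇒y≤1 (suc x) y _ le = *-cancelˡ-≤ (suc x) (≤-trans le (≤-reflexive (sym (*-identityʳ (suc x)))))

x≤1⇒x+0≡1 : ∀ x → 1 ≤ x → x ≤ 1 → x + 0 ≡ 1
x≤1⇒x+0≡1 x 1≤x x≤1 = trans (+-identityʳ x) (≤-antisym x≤1 1≤x)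

-- For a separation S of G, read a, b, c, d as |Y ∩ S|, |Y ∖ S|, |Ȳ ∩ S|, |Ȳ ∖ S|.
a*d+b*c≤a+b⇒a+c≡1⊎b+d≡1 : ∀ a b c d → 1 ≤ a + b → a + b ≤ c + d → 5 ≤ a + b + (c + d) →
  a * d + b * c ≤ a + b → 1 ≤ a + c → 1 ≤ b + d → a + c ≡ 1 ⊎ b + d ≡ 1
a*d+b*c≤a+b⇒a+c≡1⊎b+d≡1 zero    zero    c d () _ _ _ _ _
a*d+b*c≤a+b⇒a+c≡1⊎b+d≡1 zero    (suc b) c d _ _ _ cross c≥1 _ =
  inj₁ (≤-antisym (x*y≤x⇒y≤1 (suc b) c (s≤s z≤n) cross) c≥1)
a*d+b*c≤a+b⇒a+c≡1⊎b+d≡1 (suc a) zero    c d _ _ _ cross _ d≥1 =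
  inj₂ (≤-antisym (x*y≤x⇒y≤1 (suc a) d (s≤s z≤n) (subst₂ _≤_ (+-identityʳ _) (+-identityʳ _) cross)) d≥1)
a*d+b*c≤a+b⇒a+c≡1⊎b+d≡1 (suc a) (suc b) zero    zero    _ () _ _ _ _
a*d+b*c≤a+b⇒a+c≡1⊎b+d≡1 (suc a) (suc b) zero    (suc d) _ ab≤d _ cross _ _ =
  inj₁ (x≤1⇒x+0≡1 (suc a) (s≤s z≤n) (*-cancelʳ-≤ (suc a) 1 (suc d) (begin
    suc a * suc d                    ≤⟨ m≤m+n _ _ ⟩
    suc a * suc d + suc b * zero     ≤⟨ cross ⟩
    suc a + suc b                    ≤⟨ ≤-trans ab≤d (≤-reflexive (sym (*-identityˡ (suc d)))) ⟩
    1 * suc d                        ∎)))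
  where open ≤-Reasoning
a*d+b*c≤a+b⇒a+c≡1⊎b+d≡1 (suc a) (suc b) (suc c) zero    _ ab≤c _ cross _ _ =
  inj₂ (x≤1⇒x+0≡1 (suc b) (s≤s z≤n) (*-cancelʳ-≤ (suc b) 1 (suc c) (begin
    suc b * suc c                    ≤⟨ m≤n+m _ _ ⟩
    suc a * zero + suc b * suc c     ≤⟨ cross ⟩
    suc a + suc b                    ≤⟨ ab≤c ⟩
    suc c + 0                        ≡⟨ trans (+-identityʳ (suc c)) (sym (*-identityˡ (suc c))) ⟩
    1 * suc c                        ∎)))
  where open ≤-Reasoning
a*d+b*c≤a+b⇒a+c≡1⊎b+d≡1 (suc a) (suc b) (suc c) (suc d) _ ab≤cd five cross _ _ =
  contradiction (≤-trans five (+-mono-≤ (≤-trans ab≤cd cd≤2) cd≤2)) λ { (s≤s (s≤s (s≤s (s≤s ())))) }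
  where
  d≤1 : suc d ≤ 1
  d≤1 = x*y≤x⇒y≤1 (suc a) (suc d) (s≤s z≤n)
    (+-cancelʳ-≤ (suc b) _ _ (≤-trans (+-monoʳ-≤ (suc a * suc d) (m≤m*n (suc b) (suc c))) cross))
  c≤1 : suc c ≤ 1
  c≤1 = x*y≤x⇒y≤1 (suc b) (suc c) (s≤s z≤n)
    (+-cancelˡ-≤ (suc a) _ _ (≤-trans (+-monoˡ-≤ (suc b * suc c) (m≤m*n (suc a) (suc d))) cross))
  cd≤2 : suc c + suc d ≤ 2
  cd≤2 = +-mono-≤ c≤1 d≤1

k*d≤m*[m∸1]+d⇒m≡k×d≡k : ∀ m k d → 1 ≤ m → 2 ≤ k → m ≤ k → m ≤ d → k * d ≤ m * (m ∸ 1) + d →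
  m ≡ k × d ≡ k
k*d≤m*[m∸1]+d⇒m≡k×d≡k (suc m) (suc zero)    d _ (s≤s ()) _ _ _
k*d≤m*[m∸1]+d⇒m≡k×d≡k (suc m) (suc (suc k)) d _ _ m≤k m≤d le = m≡k , d≡k
  where
  open ≤-Reasoning
  k*d≤ : suc k * d ≤ suc m * m
  k*d≤ = +-cancelʳ-≤ d _ _ (≤-trans (≤-reflexive (+-comm (suc k * d) d)) le)
  k≤m : suc k ≤ m
  k≤m = *-cancelʳ-≤ (suc k) m (suc m) (begin
    suc k * suc m  ≤⟨ *-monoʳ-≤ (suc k) m≤d ⟩
    suc k * d      ≤⟨ k*d≤ ⟩
    suc m * m      ≡⟨ *-comm (suc m) m ⟩
    m * suc m      ∎)
  m≡k : suc m ≡ suc (suc k)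
  m≡k = ≤-antisym m≤k (s≤s k≤m)
  d≤k : d ≤ suc (suc k)
  d≤k = *-cancelˡ-≤ (suc k) (begin
    suc k * d                  ≤⟨ k*d≤ ⟩
    suc m * m                  ≡⟨ cong (λ x → x * pred x) m≡k ⟩
    suc (suc k) * suc k        ≡⟨ *-comm (suc (suc k)) (suc k) ⟩
    suc k * suc (suc k)        ∎)
  d≡k : d ≡ suc (suc k)
  d≡k = ≤-antisym d≤k (≤-trans (≤-reflexive (sym m≡k)) m≤d)

k*k≤3k+v⇒k*[k∸3]≤v : ∀ k v → k * k ≤ k + k + (k + v) → k * (k ∸ 3) ≤ v
k*k≤3k+v⇒k*[k∸3]≤v k v le = begin
  k * (k ∸ 3)    ≡⟨ *-distribˡ-∸ k k 3 ⟩
  k * k ∸ k * 3  ≤⟨ m≤n+o⇒m∸n≤o (k * k) (k * 3) (≤-trans le (≤-reflexive (rearranged k v))) ⟩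
  v              ∎
  where
  open ≤-Reasoning
  rearranged : ∀ k v → k + k + (k + v) ≡ k * 3 + v
  rearranged = solve-∀

≤-half : ∀ m y → m ≤ y → m ≤ (m + y) / 2
≤-half m y m≤y = ≤-trans (≤-reflexive (sym (m*n/n≡m m 2))) (/-monoˡ-≤ 2 (begin
  m * 2      ≡⟨ *-comm m 2 ⟩
  m + (m + 0) ≡⟨ cong (m +_) (+-identityʳ m) ⟩
  m + m      ≤⟨ +-monoʳ-≤ m m≤y ⟩
  m + y      ∎))
  where open ≤-Reasoning

m+x≡r+m*2⇒x≡r+m : ∀ m x r → m + x ≡ r + m * 2 → x ≡ r + m
m+x≡r+m*2⇒x≡r+m m x r e = +-cancelˡ-≡ m x (r + m) (trans e (rearranged m r))
  where
  rearranged : ∀ m r → r + m * 2 ≡ m + (r + m)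
  rearranged = solve-∀

odd-half : ∀ n → n % 2 ≡ 1 → (n ∸ 1) / 2 ≡ n / 2
odd-half n odd = trans (cong (λ x → (x ∸ 1) / 2) (trans (m≡m%n+[m/n]*n n 2) (cong (_+ n / 2 * 2) odd)))
                       (m*n/n≡m (n / 2) 2)

ratio≡1/k⇒d≡k*b : ∀ b d k → 0 < d → 0 < k → ratio b d ≡ ratio 1 k → d ≡ k * b
ratio≡1/k⇒d≡k*b b (suc d) (suc k) _ _ eq with /-injective-≃ (mkℚᵘ (ℤ.+ b) d) (mkℚᵘ (ℤ.+ 1) k) eq
... | *≡* p = trans (sym (*-identityˡ (suc d))) (sym (trans (*-comm (suc k) b)
        (ℤ.+-injective (trans (ℤ.pos-* b (suc k)) (trans p (sym (ℤ.pos-* 1 (suc d))))))))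

indicator : Bool → ℕ
indicator b = if b then 1 else 0

_⊆ᵇ_ : ∀ {n} → (Fin n → Bool) → (Fin n → Bool) → Set
f ⊆ᵇ g = ∀ i → f i ≡ true → g i ≡ true

sumOver : (Fin n → Bool) → (Fin n → ℕ) → ℕ
sumOver X f = sumF (λ x → if X x then f x else 0)

sumF-cong : {f g : Fin n → ℕ} → (∀ i → f i ≡ g i) → sumF f ≡ sumF g
sumF-cong {zero}  e = refl
sumF-cong {suc n} e = cong₂ _+_ (e zero) (sumF-cong (e ∘ suc))

countF-cong : {f g : Fin n → Bool} → (∀ i → f i ≡ g i) → countF f ≡ countF g
countF-cong {zero}  e = refl
countF-cong {suc n} e = cong₂ _+_ (cong indicator (e zero)) (countF-cong (e ∘ suc))

sumF-mono-≤ : {f g : Fin n → ℕ} → (∀ i → f i ≤ g i) → sumF f ≤ sumF g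
sumF-mono-≤ {zero}  le = z≤n
sumF-mono-≤ {suc n} le = +-mono-≤ (le zero) (sumF-mono-≤ (le ∘ suc))

countF≡sumF : (f : Fin n → Bool) → countF f ≡ sumF (indicator ∘ f)
countF≡sumF {zero}  f = refl
countF≡sumF {suc n} f = cong (indicator (f zero) +_) (countF≡sumF (f ∘ suc))

indicator-mono : ∀ {a b} → (a ≡ true → b ≡ true) → indicator a ≤ indicator b
indicator-mono {false} _ = z≤n
indicator-mono {true}  h rewrite h refl = ≤-refl

countF-mono : {f g : Fin n → Bool} → f ⊆ᵇ g → countF f ≤ countF g
countF-mono {zero}  f⊆g = z≤n
countF-mono {suc n} f⊆g = +-mono-≤ (indicator-mono (f⊆g zero)) (countF-mono (f⊆g ∘ suc))

sumF-distrib-+ : (f g : Fin n → ℕ) → sumF (λ i → f i + g i) ≡ sumF f + sumF g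
sumF-distrib-+ {zero}  f g = refl
sumF-distrib-+ {suc n} f g = trans (cong (f zero + g zero +_) (sumF-distrib-+ (f ∘ suc) (g ∘ suc)))
                                   (interchange (f zero) (g zero) _ _)

sumF-const : ∀ c {f : Fin n → ℕ} → (∀ i → f i ≡ c) → sumF f ≡ n * c
sumF-const {zero}  c e = refl
sumF-const {suc n} c e = cong₂ _+_ (e zero) (sumF-const c (e ∘ suc))

sumF-comm : ∀ {m} (F : Fin m → Fin n → ℕ) →
  sumF (λ i → sumF (F i)) ≡ sumF (λ j → sumF (λ i → F i j))
sumF-comm {n} {zero}  F = sym (trans (sumF-const {n} 0 (λ _ → refl)) (*-zeroʳ n))
sumF-comm {n} {suc m} F = trans (cong (sumF (F zero) +_) (sumF-comm (F ∘ suc)))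
                                (sym (sumF-distrib-+ (F zero) _))

sumOver-const : (X : Fin n → Bool) (c : ℕ) → sumOver X (λ _ → c) ≡ countF X * c
sumOver-const {zero}  X c = refl
sumOver-const {suc n} X c with X zero
... | true  = cong (c +_) (sumOver-const (X ∘ suc) c)
... | false = sumOver-const (X ∘ suc) c

sumF≡0⇒≡0 : (f : Fin n → ℕ) → sumF f ≡ 0 → ∀ i → f i ≡ 0
sumF≡0⇒≡0 f e zero    = m+n≡0⇒m≡0 (f zero) e
sumF≡0⇒≡0 f e (suc i) = sumF≡0⇒≡0 (f ∘ suc) (m+n≡0⇒n≡0 (f zero) e) i

sumF-remove : (f : Fin (suc n) → ℕ) (i : Fin (suc n)) → sumF f ≡ f i + sumF (f ∘ punchIn i)
sumF-remove         f zero    = refl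
sumF-remove {suc n} f (suc i) = trans (cong (f zero +_) (sumF-remove (f ∘ suc) i))
                                      (x∙yz≈y∙xz (f zero) (f (suc i)) _)

countF-remove : (f : Fin (suc n) → Bool) (i : Fin (suc n)) →
  countF f ≡ indicator (f i) + countF (f ∘ punchIn i)
countF-remove f i = begin
  countF f                                            ≡⟨ countF≡sumF f ⟩
  sumF (indicator ∘ f)                                ≡⟨ sumF-remove (indicator ∘ f) i ⟩
  indicator (f i) + sumF (indicator ∘ f ∘ punchIn i)  ≡⟨ cong (indicator (f i) +_) (countF≡sumF (f ∘ punchIn i)) ⟨
  indicator (f i) + countF (f ∘ punchIn i)            ∎
  where open ≡-Reasoning

countF≤n : (f : Fin n → Bool) → countF f ≤ n
countF≤n {zero}  f = z≤n
countF≤n {suc n} f with f zero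
... | true  = s≤s (countF≤n (f ∘ suc))
... | false = m≤n⇒m≤1+n (countF≤n (f ∘ suc))

countF+countF-not : (f : Fin n → Bool) → countF f + countF (not ∘ f) ≡ n
countF+countF-not {zero}  f = refl
countF+countF-not {suc n} f with f zero
... | true  = cong suc (countF+countF-not (f ∘ suc))
... | false = trans (+-suc (countF (f ∘ suc)) _) (cong suc (countF+countF-not (f ∘ suc)))

countF-split : (f g : Fin n → Bool) →
  countF f ≡ countF (λ i → f i ∧ g i) + countF (λ i → f i ∧ not (g i))
countF-split {zero}  f g = refl
countF-split {suc n} f g with f zero | g zero
... | true  | true  = cong suc (countF-split (f ∘ suc) (g ∘ suc))
... | true  | false = trans (cong suc (countF-split (f ∘ suc) (g ∘ suc))) (sym (+-suc _ _))
... | false | _     = countF-split (f ∘ suc) (g ∘ suc)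

countF≡0⇒false : (f : Fin n → Bool) → countF f ≡ 0 → ∀ i → f i ≡ false
countF≡0⇒false {suc n} f e i with f zero in f₀
countF≡0⇒false {suc n} f e zero    | false = f₀
countF≡0⇒false {suc n} f e (suc i) | false = countF≡0⇒false (f ∘ suc) e i

countF-witness : (f : Fin n → Bool) → 0 < countF f → ∃ λ i → f i ≡ true
countF-witness {suc n} f pos with f zero in f₀
... | true  = zero , f₀
... | false with countF-witness (f ∘ suc) pos
...   | i , fi = suc i , fi

countF-positive : (f : Fin n → Bool) (i : Fin n) → f i ≡ true → 1 ≤ countF f
countF-positive {suc n} f i fi rewrite countF-remove f i | fi = s≤s z≤n

countF-<-witness : {f g : Fin n → Bool} (v : Fin n) → f ⊆ᵇ g → f v ≡ false → g v ≡ true →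
  suc (countF f) ≤ countF g
countF-<-witness {suc n} {f} {g} v f⊆g fv gv
  rewrite countF-remove f v | countF-remove g v | fv | gv =
  s≤s (countF-mono (f⊆g ∘ punchIn v))

sumF-≤-tight : (f g : Fin n → ℕ) → (∀ i → f i ≤ g i) → sumF g ≤ sumF f → ∀ i → f i ≡ g i
sumF-≤-tight {suc n} f g f≤g Σg≤Σf zero    = f₀≡g₀ f g f≤g Σg≤Σf
  where
  f₀≡g₀ : (f g : Fin (suc n) → ℕ) → (∀ i → f i ≤ g i) → sumF g ≤ sumF f → f zero ≡ g zero
  f₀≡g₀ f g f≤g Σg≤Σf = ≤-antisym (f≤g zero)
    (+-cancelʳ-≤ (sumF (f ∘ suc)) _ _ (≤-trans (+-monoʳ-≤ (g zero) (sumF-mono-≤ (f≤g ∘ suc))) Σg≤Σf))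
sumF-≤-tight {suc n} f g f≤g Σg≤Σf (suc i) =
  sumF-≤-tight (f ∘ suc) (g ∘ suc) (f≤g ∘ suc)
    (+-cancelˡ-≤ (g zero) _ _ (subst (λ x → g zero + _ ≤ x + _) (sumF-≤-tight f g f≤g Σg≤Σf zero) Σg≤Σf)) i

pigeonhole : (X : Fin n → Bool) (f : Fin n → ℕ) → sumOver X f < countF X →
  ∃ λ i → X i ≡ true × f i ≡ 0
pigeonhole {suc n} X f lt with X zero in X₀ | f zero in f₀
... | true  | zero  = zero , X₀ , f₀
... | true  | suc m = map suc id (pigeonhole (X ∘ suc) (f ∘ suc) (≤-trans (s≤s (m≤n+m _ m)) (≤-pred lt)))
... | false | _     = map suc id (pigeonhole (X ∘ suc) (f ∘ suc) lt)

sumF-↑ : ∀ k {l} (f : Fin (k + l) → ℕ) → sumF f ≡ sumF (f ∘ (_↑ˡ l)) + sumF (f ∘ (k ↑ʳ_))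
sumF-↑ zero    f = refl
sumF-↑ (suc k) f = trans (cong (f zero +_) (sumF-↑ k (f ∘ suc))) (sym (+-assoc (f zero) _ _))

sumF≡sum : (f : Fin n → ℕ) → sumF f ≡ sum f
sumF≡sum {zero}  f = refl
sumF≡sum {suc n} f = cong (f zero +_) (sumF≡sum (f ∘ suc))

sumF-↔ : ∀ {m} (π : Fin m ↔ Fin n) (f : Fin n → ℕ) → sumF f ≡ sumF (f ∘ Inverse.to π)
sumF-↔ π f = begin
  sumF f                    ≡⟨ sumF≡sum f ⟩
  sum f                     ≡⟨ sum-permute f π ⟩
  sum (f ∘ Inverse.to π)    ≡⟨ sumF≡sum (f ∘ Inverse.to π) ⟨
  sumF (f ∘ Inverse.to π)   ∎
  where open ≡-Reasoning

countF-⊆-tight : {f g : Fin n → Bool} → f ⊆ᵇ g → countF g ≤ countF f → g ⊆ᵇ f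
countF-⊆-tight {f = f} {g} f⊆g #g≤#f i gi = indicator≡1 (f i) (trans equal (cong indicator gi))
  where
  equal : indicator (f i) ≡ indicator (g i)
  equal = sumF-≤-tight (indicator ∘ f) (indicator ∘ g) (λ j → indicator-mono (f⊆g j))
            (subst₂ _≤_ (countF≡sumF g) (countF≡sumF f) #g≤#f) i
  indicator≡1 : ∀ b → indicator b ≡ 1 → b ≡ true
  indicator≡1 true _ = refl

term≤sumF : (f : Fin n → ℕ) (i : Fin n) → f i ≤ sumF f
term≤sumF {suc n} f i = ≤-trans (m≤m+n (f i) _) (≤-reflexive (sym (sumF-remove f i)))

sumF-zero : {f : Fin n → ℕ} → (∀ i → f i ≡ 0) → sumF f ≡ 0
sumF-zero {n} zeros = trans (sumF-const 0 zeros) (*-zeroʳ n)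

countF-false : countF {n} (λ _ → false) ≡ 0
countF-false {zero}  = refl
countF-false {suc n} = countF-false {n}

countF-true : countF {n} (λ _ → true) ≡ n
countF-true {zero}  = refl
countF-true {suc n} = cong suc (countF-true {n})

sumOver-distrib-+ : (X : VSet n) (f g : Fin n → ℕ) → sumOver X (λ x → f x + g x) ≡ sumOver X f + sumOver X g
sumOver-distrib-+ X f g =
  trans (sumF-cong pointwise) (sumF-distrib-+ (λ x → if X x then f x else 0) (λ x → if X x then g x else 0))
  where
  pointwise : ∀ x → (if X x then f x + g x else 0) ≡ (if X x then f x else 0) + (if X x then g x else 0)
  pointwise x with X x
  ... | true  = refl
  ... | false = refl

countF≡suc-others : (X : VSet (suc n)) (x : Fin (suc n)) → X x ≡ true → countF X ≡ suc (countF (X ∘ punchIn x))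
countF≡suc-others X x Xx = trans (countF-remove X x) (cong (λ b → indicator b + countF (X ∘ punchIn x)) Xx)

-- Reachability

anyᵇ : (Fin n → Bool) → Bool
anyᵇ f = does (any? (λ i → f i Bool.≟ true))

anyᵇ-witness : (f : Fin n → Bool) → anyᵇ f ≡ true → ∃ λ i → f i ≡ true
anyᵇ-witness f e with any? (λ i → f i Bool.≟ true)
... | yes p = p

anyᵇ-intro : (f : Fin n → Bool) (i : Fin n) → f i ≡ true → anyᵇ f ≡ true
anyᵇ-intro f i fi = dec-true (any? (λ i → f i Bool.≟ true)) (i , fi)

closed-superset : (Φ : VSet n → VSet n) → (∀ X → X ⊆ᵇ Φ X) →
  (Inv : VSet n → Set) → (∀ X → Inv X → Inv (Φ X)) →
  ∀ X → Inv X → Σ (VSet n) λ S → X ⊆ᵇ S × Φ S ⊆ᵇ S × Inv S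
closed-superset {n} Φ inflationary Inv preserved X inv = go (suc n) X inv (s≤s (m≤m+n n (countF X)))
  where
  -- Each step that is not yet stable adds a vertex, so the fuel never runs out.
  go : ∀ fuel X → Inv X → n < fuel + countF X → Σ (VSet n) λ S → X ⊆ᵇ S × Φ S ⊆ᵇ S × Inv S
  go fuel X inv bound with any? (λ v → (Φ X v Bool.≟ true) ×-dec (X v Bool.≟ false))
  ... | no stable = X , (λ _ Xi → Xi) , closed , inv
    where
    closed : Φ X ⊆ᵇ X
    closed v Φv with X v in Xv
    ... | true  = refl
    ... | false = contradiction (v , Φv , Xv) stable
  go zero X inv bound | yes _ = contradiction bound (≤⇒≯ (countF≤n X))
  go (suc fuel) X inv bound | yes (v , Φv , Xv) =
    let S , X⊆S , closed , invS = go fuel (Φ X) (preserved X inv) bound′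
    in S , (λ i → X⊆S i ∘ inflationary X i) , closed , invS
    where
    bound′ : n < fuel + countF (Φ X)
    bound′ = ≤-trans bound (≤-trans (≤-reflexive (sym (+-suc fuel _)))
                                    (+-monoʳ-≤ fuel (countF-<-witness v (inflationary X) Xv Φv)))

Reachable-trans : {A : Adj n} {u v w : Fin n} → Reachable A u v → Reachable A v w → Reachable A u w
Reachable-trans here         q = q
Reachable-trans (step e p)   q = step e (Reachable-trans p q)

Reachable-sym : {A : Adj n} → (∀ i j → A i j ≡ A j i) → {u v : Fin n} → Reachable A u v → Reachable A v u
Reachable-sym A-sym here                 = here
Reachable-sym A-sym (step {u} {v} e p) = Reachable-trans (Reachable-sym A-sym p) (step (trans (A-sym v u) e) here)

Separated : Adj n → VSet n → Set
Separated G S = ∀ a b → S a ≡ true → S b ≡ false → G a b ≡ false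

disconnected⇒separated : (G : Adj n) → (∀ i j → G i j ≡ G j i) → Disconnected G → Fin n →
  Σ (VSet n) λ S → (∃ λ a → S a ≡ true) × (∃ λ b → S b ≡ false) × Separated G S
disconnected⇒separated {n} G G-sym disconnected v₀ =
  S , (v₀ , v₀∈S) , outside , separated
  where
  Φ : VSet n → VSet n
  Φ X v = X v ∨ anyᵇ (λ u → G v u ∧ X u)

  Φ-inflationary : ∀ X → X ⊆ᵇ Φ X
  Φ-inflationary X v Xv rewrite Xv = refl

  ReachesV₀ : VSet n → Set
  ReachesV₀ X = ∀ v → X v ≡ true → Reachable G v v₀

  Φ-preserves : ∀ X → ReachesV₀ X → ReachesV₀ (Φ X)
  Φ-preserves X reach v Φv with X v in Xv
  ... | true  = reach v Xv
  ... | false with anyᵇ-witness _ Φv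
  ...   | u , Gvu∧Xu = step (Bool.∧-conicalˡ _ _ Gvu∧Xu) (reach u (Bool.∧-conicalʳ _ _ Gvu∧Xu))

  singleton : VSet n
  singleton v = does (v ≟ v₀)

  singleton-reaches : ReachesV₀ singleton
  singleton-reaches v e with v ≟ v₀
  ... | yes refl = here

  component = closed-superset Φ Φ-inflationary ReachesV₀ Φ-preserves singleton singleton-reaches

  S : VSet n
  S = proj₁ component

  S-closed : Φ S ⊆ᵇ S
  S-closed = proj₁ (proj₂ (proj₂ component))

  S-reaches : ReachesV₀ S
  S-reaches = proj₂ (proj₂ (proj₂ component))

  v₀∈S : S v₀ ≡ true
  v₀∈S = proj₁ (proj₂ component) v₀ (dec-true (v₀ ≟ v₀) refl)

  separated : Separated G S
  separated a b Sa Sb with G a b in Gab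
  ... | false = refl
  ... | true  = contradiction (trans (sym (S-closed b Φb)) Sb) λ ()
    where
    Φb : Φ S b ≡ true
    Φb rewrite Sb = anyᵇ-intro _ a (cong₂ _∧_ (trans (G-sym b a) Gab) Sa)

  outside : ∃ λ b → S b ≡ false
  outside with any? (λ b → S b Bool.≟ false)
  ... | yes b = b
  ... | no none = contradiction (λ u v → Reachable-trans (reaches u) (Reachable-sym G-sym (reaches v))) disconnected
    where
    reaches : ∀ v → Reachable G v v₀
    reaches v with S v in Sv
    ... | true  = S-reaches v Sv
    ... | false = contradiction (v , Sv) none

separated-compl : {G : Adj n} {S : VSet n} → (∀ i j → G i j ≡ G j i) → Separated G S → Separated G (compl S)
separated-compl G-sym separated a b Sa Sb =
  trans (G-sym a b) (separated b a (Bool.not-injective Sb) (Bool.not-injective Sa))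

Clique : Adj n → VSet n → Set
Clique A X = ∀ i j → X i ≡ true → X j ≡ true → i ≢ j → A i j ≡ true

Dominating : Adj n → Fin n → Set
Dominating A w = ∀ v → v ≢ w → A w v ≡ true

induced : ∀ {l} → Adj n → (Fin l → Fin n) → Adj l
induced A e b b′ = A (e b) (e b′)

⌊≟⌋-refl : (i : Fin n) → ⌊ i ≟ i ⌋ ≡ true
⌊≟⌋-refl i with i ≟ i
... | yes _   = refl
... | no i≢i = contradiction refl i≢i

⌊≟⌋-≢ : {i j : Fin n} → i ≢ j → ⌊ i ≟ j ⌋ ≡ false
⌊≟⌋-≢ {i = i} {j} i≢j with i ≟ j
... | yes i≡j = contradiction i≡j i≢j
... | no _    = refl

true≢false : true ≢ false
true≢false ()

differ⇒≢ : (X : VSet n) {i j : Fin n} → X i ≡ true → X j ≡ false → i ≢ j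
differ⇒≢ X Xi Xj refl = true≢false (trans (sym Xi) Xj)

induced-simple : ∀ {l} {A : Adj n} → Simple A → (e : Fin l → Fin n) → Simple (induced A e)
induced-simple simple e = record
  { symm   = λ b b′ → Simple.symm simple (e b) (e b′)
  ; irrefl = λ b → Simple.irrefl simple (e b)
  }

module _ {G : Adj n} where

  complement-simple : Simple G → Simple (complement G)
  complement-simple simple = record { symm = symm ; irrefl = irrefl }
    where
    symm : ∀ i j → complement G i j ≡ complement G j i
    symm i j with i ≟ j
    ... | yes refl = cong (λ b → not (G i i) ∧ not b) (sym (⌊≟⌋-refl i))
    ... | no i≢j   = cong₂ (λ a b → not a ∧ not b) (Simple.symm simple i j) (sym (⌊≟⌋-≢ (i≢j ∘ sym)))
    irrefl : ∀ i → complement G i i ≡ false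
    irrefl i rewrite ⌊≟⌋-refl i = Bool.∧-zeroʳ (not (G i i))

  complement-true : {i j : Fin n} → i ≢ j → G i j ≡ false → complement G i j ≡ true
  complement-true i≢j Gij rewrite ⌊≟⌋-≢ i≢j | Gij = refl

  complement-false : {i j : Fin n} → i ≢ j → complement G i j ≡ false → G i j ≡ true
  complement-false {i} {j} i≢j Cij with G i j
  ... | true  = refl
  ... | false = contradiction (subst (λ b → not b ≡ false) (⌊≟⌋-≢ i≢j) Cij) true≢false

CompletelyJoined : Adj n → VSet n → Set
CompletelyJoined A S = ∀ a b → S a ≡ true → S b ≡ false → A a b ≡ true

separated⇒joined-in-complement : {G : Adj n} {S : VSet n} → Separated G S → CompletelyJoined (complement G) S
separated⇒joined-in-complement {G = G} {S} separated a b Sa Sb =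
  complement-true {G = G} (differ⇒≢ S Sa Sb) (separated a b Sa Sb)

-- Boundary and volume

innerDeg outerDeg : Adj n → VSet n → Fin n → ℕ
innerDeg A X x = countF (λ y → A x y ∧ X y)
outerDeg A X x = countF (λ y → A x y ∧ not (X y))

module _ (A : Adj n) (X : VSet n) where

  boundary≡sumOver-outerDeg : boundary A X ≡ sumOver X (outerDeg A X)
  boundary≡sumOver-outerDeg = sumF-cong pointwise
    where
    pointwise : ∀ x → countF (λ y → X x ∧ not (X y) ∧ A x y) ≡ (if X x then outerDeg A X x else 0)
    pointwise x with X x
    ... | true  = countF-cong (λ y → Bool.∧-comm (not (X y)) (A x y))
    ... | false = countF-false {n}

  vol≡internalVol+boundary : vol A X ≡ sumOver X (innerDeg A X) + boundary A X
  vol≡internalVol+boundary = begin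
    vol A X
      ≡⟨ sumF-cong (λ x → cong (if X x then_else 0) (countF-split (A x) X)) ⟩
    sumOver X (λ x → innerDeg A X x + outerDeg A X x)
      ≡⟨ sumOver-distrib-+ X (innerDeg A X) (outerDeg A X) ⟩
    sumOver X (innerDeg A X) + sumOver X (outerDeg A X)
      ≡⟨ cong (sumOver X (innerDeg A X) +_) boundary≡sumOver-outerDeg ⟨
    sumOver X (innerDeg A X) + boundary A X ∎
    where open ≡-Reasoning

  boundary-compl : (∀ i j → A i j ≡ A j i) → boundary A (compl X) ≡ boundary A X
  boundary-compl A-sym = begin
    boundary A (compl X)
      ≡⟨ sumF-cong (λ x → countF≡sumF (crossing (compl X) x)) ⟩
    sumF (λ x → sumF (λ y → indicator (crossing (compl X) x y)))
      ≡⟨ sumF-comm (λ x y → indicator (crossing (compl X) x y)) ⟩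
    sumF (λ y → sumF (λ x → indicator (crossing (compl X) x y)))
      ≡⟨ sumF-cong (λ y → sumF-cong (λ x → cong indicator (transposed x y))) ⟩
    sumF (λ y → sumF (λ x → indicator (crossing X y x)))
      ≡⟨ sumF-cong (λ y → countF≡sumF (crossing X y)) ⟨
    boundary A X ∎
    where
    open ≡-Reasoning
    crossing : VSet n → Fin n → Fin n → Bool
    crossing Y x y = Y x ∧ not (Y y) ∧ A x y
    transposed : ∀ x y → crossing (compl X) x y ≡ crossing X y x
    transposed x y rewrite A-sym x y with X x | X y
    ... | true  | true  = refl
    ... | true  | false = refl
    ... | false | true  = refl
    ... | false | false = refl

vol-cong : (A : Adj n) {X Y : VSet n} → (∀ i → X i ≡ Y i) → vol A X ≡ vol A Y
vol-cong A X≗Y = sumF-cong (λ i → cong (if_then deg A i else 0) (X≗Y i))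

compl-compl : (X : VSet n) → ∀ i → compl (compl X) i ≡ X i
compl-compl X i = Bool.not-involutive (X i)

innerDeg≡countF-others : {A : Adj (suc n)} → Simple A → (X : VSet (suc n)) (x : Fin (suc n)) →
  innerDeg A X x ≡ countF ((λ y → A x y ∧ X y) ∘ punchIn x)
innerDeg≡countF-others {A = A} simple X x =
  trans (countF-remove (λ y → A x y ∧ X y) x)
        (cong (λ b → indicator (b ∧ X x) + countF ((λ y → A x y ∧ X y) ∘ punchIn x)) (Simple.irrefl simple x))

innerDeg≤ : {A : Adj n} → Simple A → (X : VSet n) (x : Fin n) → X x ≡ true → innerDeg A X x ≤ countF X ∸ 1
innerDeg≤ {suc n} {A} simple X x Xx rewrite innerDeg≡countF-others simple X x | countF≡suc-others X x Xx =
  countF-mono (λ y → Bool.∧-conicalʳ (A x (punchIn x y)) (X (punchIn x y)))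

saturated-innerDeg⇒adjacent : {A : Adj n} → Simple A → (X : VSet n) (i : Fin n) → X i ≡ true →
  countF X ∸ 1 ≤ innerDeg A X i → ∀ j → X j ≡ true → i ≢ j → A i j ≡ true
saturated-innerDeg⇒adjacent {suc n} {A} simple X i Xi saturated j Xj i≢j =
  Bool.∧-conicalˡ _ _ (subst (λ v → A i v ∧ X v ≡ true) (punchIn-punchOut i≢j)
    (others⊆neighbours (punchOut i≢j) (subst (λ v → X v ≡ true) (sym (punchIn-punchOut i≢j)) Xj)))
  where
  others⊆neighbours : (X ∘ punchIn i) ⊆ᵇ ((λ v → A i v ∧ X v) ∘ punchIn i)
  others⊆neighbours = countF-⊆-tight (λ y → Bool.∧-conicalʳ (A i (punchIn i y)) (X (punchIn i y)))
    (subst₂ _≤_ (cong (_∸ 1) (countF≡suc-others X i Xi)) (innerDeg≡countF-others simple X i) saturated)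

module _ {A : Adj n} (simple : Simple A) (X : VSet n) where

  innerDeg≤-pointwise : ∀ x → (if X x then innerDeg A X x else 0) ≤ (if X x then countF X ∸ 1 else 0)
  innerDeg≤-pointwise x with X x in Xx
  ... | true  = innerDeg≤ simple X x Xx
  ... | false = z≤n

  internalVol≤ : sumOver X (innerDeg A X) ≤ countF X * (countF X ∸ 1)
  internalVol≤ = ≤-trans (sumF-mono-≤ innerDeg≤-pointwise) (≤-reflexive (sumOver-const X (countF X ∸ 1)))

  clique-of-tight-internalVol : countF X * (countF X ∸ 1) ≤ sumOver X (innerDeg A X) → Clique A X
  clique-of-tight-internalVol tight i j Xi =
    saturated-innerDeg⇒adjacent simple X i Xi (≤-reflexive (sym innerDeg≡)) j
    where
    saturated : ∀ x → (if X x then innerDeg A X x else 0) ≡ (if X x then countF X ∸ 1 else 0)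
    saturated = sumF-≤-tight _ _ innerDeg≤-pointwise (≤-trans (≤-reflexive (sumOver-const X (countF X ∸ 1))) tight)
    innerDeg≡ : innerDeg A X i ≡ countF X ∸ 1
    innerDeg≡ = subst (λ b → (if b then innerDeg A X i else 0) ≡ (if b then countF X ∸ 1 else 0)) Xi (saturated i)

  clique-of-volume : ∀ {k} → countF X ≡ k → boundary A X ≤ k → k * k ≤ vol A X → Clique A X
  clique-of-volume {k} refl ∂≤k k²≤vol = clique-of-tight-internalVol
    (k*k≤i+b⇒k*[k∸1]≤i k _ _ ∂≤k (≤-trans k²≤vol (≤-reflexive (vol≡internalVol+boundary A X))))

module _ {G : Adj n} (simple : Simple G) where

  private
    C : Adj n
    C = complement G

  no-outerDeg⇒adjacent : (Z : VSet n) (u : Fin n) → outerDeg C Z u ≡ 0 → Z u ≡ true →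
    ∀ z → Z z ≡ false → G u z ≡ true
  no-outerDeg⇒adjacent Z u isolated Zu z Zz = complement-false {G = G} (differ⇒≢ Z Zu Zz)
    (trans (sym (Bool.∧-identityʳ (C u z))) (subst (λ b → C u z ∧ not b ≡ false) Zz (countF≡0⇒false _ isolated z)))

  boundary-of-complement≥ : Disconnected G → (Y : VSet n) → countF Y ⊓ countF (compl Y) ≤ boundary C Y
  boundary-of-complement≥ disconnected Y with countF Y ⊓ countF (compl Y) ≤? boundary C Y
  ... | yes large = large
  -- Otherwise pigeonhole gives u ∈ Y and w ∉ Y with no C-edge leaving their side, so in G
  -- u is adjacent to all of Ȳ and w to all of Y.
  ... | no small = contradiction connected disconnected
    where
    ∂<min = ≰⇒> small
    inside = pigeonhole Y (outerDeg C Y)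
      (subst (_< countF Y) (boundary≡sumOver-outerDeg C Y) (<-≤-trans ∂<min (m⊓n≤m _ _)))
    outside = pigeonhole (compl Y) (outerDeg C (compl Y))
      (subst (_< countF (compl Y))
             (trans (sym (boundary-compl C Y (Simple.symm (complement-simple simple))))
                    (boundary≡sumOver-outerDeg C (compl Y)))
             (<-≤-trans ∂<min (m⊓n≤n _ _)))
    u = proj₁ inside
    w = proj₁ outside
    Yu = proj₁ (proj₂ inside)
    Yw = Bool.not-injective (proj₁ (proj₂ outside))
    u→outside : ∀ z → Y z ≡ false → G u z ≡ true
    u→outside = no-outerDeg⇒adjacent Y u (proj₂ (proj₂ inside)) Yu
    w→inside : ∀ z → Y z ≡ true → G w z ≡ true
    w→inside z Yz = no-outerDeg⇒adjacent (compl Y) w (proj₂ (proj₂ outside)) (proj₁ (proj₂ outside)) z (cong not Yz)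
    reaches-u : ∀ z → Reachable G z u
    reaches-u z with Y z in Yz
    ... | false = step (trans (Simple.symm simple z u) (u→outside z Yz)) here
    ... | true  = step (trans (Simple.symm simple z w) (w→inside z Yz))
                       (step (trans (Simple.symm simple w u) (u→outside w Yw)) here)
    connected : Connected G
    connected a b = Reachable-trans (reaches-u a) (Reachable-sym (Simple.symm simple) (reaches-u b))

module _ {A : Adj n} (simple : Simple A) where

  boundary≥cross-products : {S : VSet n} → CompletelyJoined A S → (Y : VSet n) →
    countF (λ u → Y u ∧ S u) * countF (λ u → not (Y u) ∧ not (S u)) +
    countF (λ u → Y u ∧ not (S u)) * countF (λ u → not (Y u) ∧ S u) ≤ boundary A Y
  boundary≥cross-products {S} joined Y = begin
    countF YS * d + countF YS′ * c
      ≡⟨ cong₂ _+_ (sumOver-const YS d) (sumOver-const YS′ c) ⟨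
    sumOver YS (λ _ → d) + sumOver YS′ (λ _ → c)
      ≡⟨ sumF-distrib-+ (λ u → if YS u then d else 0) (λ u → if YS′ u then c else 0) ⟨
    sumF (λ u → (if YS u then d else 0) + (if YS′ u then c else 0))
      ≤⟨ sumF-mono-≤ pointwise ⟩
    sumOver Y (outerDeg A Y)
      ≡⟨ boundary≡sumOver-outerDeg A Y ⟨
    boundary A Y ∎
    where
    open ≤-Reasoning
    YS YS′ : VSet n
    YS  u = Y u ∧ S u
    YS′ u = Y u ∧ not (S u)
    c = countF (λ u → not (Y u) ∧ S u)
    d = countF (λ u → not (Y u) ∧ not (S u))
    pointwise : ∀ u → (if YS u then d else 0) + (if YS′ u then c else 0) ≤ (if Y u then outerDeg A Y u else 0)
    pointwise u with Y u | S u in Su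
    ... | false | _     = z≤n
    ... | true  | true  = ≤-trans (≤-reflexive (+-identityʳ d)) (countF-mono across)
      where
      across : ∀ y → not (Y y) ∧ not (S y) ≡ true → A u y ∧ not (Y y) ≡ true
      across y e with Y y | S y in Sy
      ... | false | false = cong (_∧ true) (joined u y Su Sy)
    ... | true  | false = countF-mono across
      where
      across : ∀ y → not (Y y) ∧ S y ≡ true → A u y ∧ not (Y y) ≡ true
      across y e with Y y | S y in Sy
      ... | false | true = cong (_∧ true) (trans (Simple.symm simple u y) (joined y u Sy Su))

singleton-joined⇒dominating : {A : Adj n} {T : VSet n} → CompletelyJoined A T → countF T ≡ 1 →
  ∃ (Dominating A)
singleton-joined⇒dominating {suc n} {A} {T} joined #T≡1 = w , dominating
  where
  member = countF-witness T (≤-reflexive (sym #T≡1))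
  w = proj₁ member
  Tw = proj₂ member
  others : ∀ j → T (punchIn w j) ≡ false
  others = countF≡0⇒false (T ∘ punchIn w) (suc-injective (trans (sym (countF≡suc-others T w Tw)) #T≡1))
  dominating : Dominating A w
  dominating v v≢w = joined w v Tw
    (subst (λ x → T x ≡ false) (punchIn-punchOut (v≢w ∘ sym)) (others (punchOut (v≢w ∘ sym))))

dominating-inside⇒boundary≥ : {A : Adj n} {w : Fin n} → Dominating A w → (X : VSet n) → X w ≡ true →
  countF (compl X) ≤ boundary A X
dominating-inside⇒boundary≥ {A = A} {w} dominating X Xw = begin
  countF (compl X)                        ≤⟨ countF-mono toOutside ⟩
  outerDeg A X w                          ≡⟨ cong (if_then outerDeg A X w else 0) Xw ⟨
  (if X w then outerDeg A X w else 0)     ≤⟨ term≤sumF (λ x → if X x then outerDeg A X x else 0) w ⟩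
  sumOver X (outerDeg A X)                ≡⟨ boundary≡sumOver-outerDeg A X ⟨
  boundary A X                            ∎
  where
  open ≤-Reasoning
  toOutside : ∀ y → not (X y) ≡ true → A w y ∧ not (X y) ≡ true
  toOutside y ¬Xy = cong₂ _∧_ (dominating y (differ⇒≢ X Xw (Bool.not-injective ¬Xy) ∘ sym)) ¬Xy

-- The edges at w alone already account for |P| ≥ |∂P| boundary edges.
dominating-absorbs-boundary : {A : Adj n} → Simple A → {w : Fin n} → Dominating A w →
  (P : VSet n) → P w ≡ false → boundary A P ≤ countF P →
  ∀ u v → P u ≡ true → P v ≡ false → v ≢ w → A u v ≡ false
dominating-absorbs-boundary {suc n} {A} simple {w} dominating P Pw ∂≤#P u v Pu Pv v≢w =
  trans (Simple.symm simple u v) (trans (sym (Bool.∧-identityʳ (A v u)))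
    (subst (λ b → A v u ∧ not (not b) ≡ false) Pu (countF≡0⇒false (λ y → A v y ∧ not (compl P y)) v-isolated u)))
  where
  f : Fin (suc n) → ℕ
  f x = if not (P x) then outerDeg A (compl P) x else 0
  f-w : countF P ≤ f w
  f-w rewrite Pw = countF-mono (λ y Py → cong₂ _∧_ (dominating y (differ⇒≢ P Py Pw)) (cong not (cong not Py)))
  rest≡0 : sumF (f ∘ punchIn w) ≡ 0
  rest≡0 = m+n≤m⇒n≡0 (f w) (begin
    f w + sumF (f ∘ punchIn w)  ≡⟨ sumF-remove f w ⟨
    sumF f                      ≡⟨ boundary≡sumOver-outerDeg A (compl P) ⟨
    boundary A (compl P)        ≡⟨ boundary-compl A P (Simple.symm simple) ⟩
    boundary A P                ≤⟨ ∂≤#P ⟩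
    countF P                    ≤⟨ f-w ⟩
    f w                         ∎)
    where open ≤-Reasoning
  v-isolated : outerDeg A (compl P) v ≡ 0
  v-isolated = trans (cong (if_then outerDeg A (compl P) v else 0) (sym (cong not Pv)))
    (subst (λ x → f x ≡ 0) (punchIn-punchOut (v≢w ∘ sym)) (sumF≡0⇒≡0 (f ∘ punchIn w) rest≡0 (punchOut (v≢w ∘ sym))))

-- Cones over a clique

Parts : (Fin n → Bool) → Set
Parts P = Fin (countF P) ⊎ Fin (countF (not ∘ P))

split : (P : Fin n → Bool) → Fin n → Parts P
split {suc n} P i       with P zero
split {suc n} P zero    | true  = inj₁ zero
split {suc n} P (suc i) | true  = Sum.map suc id (split (P ∘ suc) i)
split {suc n} P zero    | false = inj₂ zero
split {suc n} P (suc i) | false = Sum.map id suc (split (P ∘ suc) i)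

merge : (P : Fin n → Bool) → Parts P → Fin n
merge {zero}  P (inj₁ ())
merge {zero}  P (inj₂ ())
merge {suc n} P x              with P zero
merge {suc n} P (inj₁ zero)    | true  = zero
merge {suc n} P (inj₁ (suc a)) | true  = suc (merge (P ∘ suc) (inj₁ a))
merge {suc n} P (inj₂ b)       | true  = suc (merge (P ∘ suc) (inj₂ b))
merge {suc n} P (inj₁ a)       | false = suc (merge (P ∘ suc) (inj₁ a))
merge {suc n} P (inj₂ zero)    | false = zero
merge {suc n} P (inj₂ (suc b)) | false = suc (merge (P ∘ suc) (inj₂ b))

merge-split : (P : Fin n → Bool) (i : Fin n) → merge P (split P i) ≡ i
merge-split {suc n} P i       with P zero
merge-split {suc n} P zero    | true  = refl
merge-split {suc n} P (suc i) | true  with split (P ∘ suc) i | merge-split (P ∘ suc) i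
... | inj₁ a | e = cong suc e
... | inj₂ b | e = cong suc e
merge-split {suc n} P zero    | false = refl
merge-split {suc n} P (suc i) | false with split (P ∘ suc) i | merge-split (P ∘ suc) i
... | inj₁ a | e = cong suc e
... | inj₂ b | e = cong suc e

split-merge : (P : Fin n → Bool) (x : Parts P) → split P (merge P x) ≡ x
split-merge {zero}  P (inj₁ ())
split-merge {zero}  P (inj₂ ())
split-merge {suc n} P x              with P zero
split-merge {suc n} P (inj₁ zero)    | true  = refl
split-merge {suc n} P (inj₁ (suc a)) | true  = cong (Sum.map suc id) (split-merge (P ∘ suc) (inj₁ a))
split-merge {suc n} P (inj₂ b)       | true  = cong (Sum.map suc id) (split-merge (P ∘ suc) (inj₂ b))
split-merge {suc n} P (inj₁ a)       | false = cong (Sum.map id suc) (split-merge (P ∘ suc) (inj₁ a))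
split-merge {suc n} P (inj₂ zero)    | false = refl
split-merge {suc n} P (inj₂ (suc b)) | false = cong (Sum.map id suc) (split-merge (P ∘ suc) (inj₂ b))

merge-inj₁ : (P : Fin n → Bool) (a : Fin (countF P)) → P (merge P (inj₁ a)) ≡ true
merge-inj₁ {suc n} P a       with P zero in P₀
merge-inj₁ {suc n} P zero    | true  = P₀
merge-inj₁ {suc n} P (suc a) | true  = merge-inj₁ (P ∘ suc) a
merge-inj₁ {suc n} P a       | false = merge-inj₁ (P ∘ suc) a

merge-inj₂ : (P : Fin n → Bool) (b : Fin (countF (not ∘ P))) → P (merge P (inj₂ b)) ≡ false
merge-inj₂ {suc n} P b       with P zero in P₀
merge-inj₂ {suc n} P b       | true  = merge-inj₂ (P ∘ suc) b
merge-inj₂ {suc n} P zero    | false = P₀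
merge-inj₂ {suc n} P (suc b) | false = merge-inj₂ (P ∘ suc) b

partition : (P : Fin n → Bool) → Parts P ↔ Fin n
partition P = mk↔ₛ′ (merge P) (split P) (merge-split P) (split-merge P)

injective-↔ : {A B : Set} (ι : A ↔ B) {x y : A} → Inverse.to ι x ≡ Inverse.to ι y → x ≡ y
injective-↔ ι {x} {y} e =
  trans (sym (Inverse.strictlyInverseʳ ι x)) (trans (cong (Inverse.from ι) e) (Inverse.strictlyInverseʳ ι y))

module _ {A : Adj n} {B : Adj m} (ι : Fin m ↔ Fin n)
         (adjacency : ∀ t s → A (Inverse.to ι t) (Inverse.to ι s) ≡ B t s) where

  private
    label = Inverse.to ι

  Isomorphic-of-labelling : Isomorphic A B
  Isomorphic-of-labelling = ↔-sym ι , λ i j →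
    trans (sym (adjacency _ _)) (cong₂ A (Inverse.strictlyInverseˡ ι i) (Inverse.strictlyInverseˡ ι j))

  deg-labelled : ∀ t → deg A (label t) ≡ deg B t
  deg-labelled t = begin
    countF (A (label t))                   ≡⟨ countF≡sumF (A (label t)) ⟩
    sumF (indicator ∘ A (label t))         ≡⟨ sumF-↔ ι (indicator ∘ A (label t)) ⟩
    sumF (indicator ∘ A (label t) ∘ label) ≡⟨ sumF-cong (cong indicator ∘ adjacency t) ⟩
    sumF (indicator ∘ B t)                 ≡⟨ countF≡sumF (B t) ⟨
    countF (B t)                           ∎
    where open ≡-Reasoning

  vol-labelled : (X : VSet n) → vol A X ≡ vol B (X ∘ label)
  vol-labelled X = trans (sumF-↔ ι _) (sumF-cong λ t → cong (if X (label t) then_else 0) (deg-labelled t))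

module _ {k l : ℕ} (K : Adj k) (H : Adj l) where

  disjUnion-↑ˡ-↑ˡ : ∀ a a′ → disjUnion K H (a ↑ˡ l) (a′ ↑ˡ l) ≡ K a a′
  disjUnion-↑ˡ-↑ˡ a a′ rewrite splitAt-↑ˡ k a l | splitAt-↑ˡ k a′ l = refl

  disjUnion-↑ˡ-↑ʳ : ∀ a b → disjUnion K H (a ↑ˡ l) (k ↑ʳ b) ≡ false
  disjUnion-↑ˡ-↑ʳ a b rewrite splitAt-↑ˡ k a l | splitAt-↑ʳ k l b = refl

  disjUnion-↑ʳ-↑ˡ : ∀ b a → disjUnion K H (k ↑ʳ b) (a ↑ˡ l) ≡ false
  disjUnion-↑ʳ-↑ˡ b a rewrite splitAt-↑ˡ k a l | splitAt-↑ʳ k l b = refl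

  disjUnion-↑ʳ-↑ʳ : ∀ b b′ → disjUnion K H (k ↑ʳ b) (k ↑ʳ b′) ≡ H b b′
  disjUnion-↑ʳ-↑ʳ b b′ rewrite splitAt-↑ʳ k l b | splitAt-↑ʳ k l b′ = refl

module _ (k : ℕ) {l : ℕ} (H : Adj l) where

  private
    B : Adj (suc (k + l))
    B = cone (disjUnion (complete k) H)

  deg-apex : deg B zero ≡ k + l
  deg-apex = countF-true

  deg-right : ∀ b → deg B (suc (k ↑ʳ b)) ≡ suc (deg H b)
  deg-right b = cong suc (begin
    countF (disjUnion (complete k) H (k ↑ʳ b))
      ≡⟨ countF≡sumF (disjUnion (complete k) H (k ↑ʳ b)) ⟩
    sumF (indicator ∘ disjUnion (complete k) H (k ↑ʳ b))
      ≡⟨ sumF-↑ k (indicator ∘ disjUnion (complete k) H (k ↑ʳ b)) ⟩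
    sumF (λ a → indicator (disjUnion (complete k) H (k ↑ʳ b) (a ↑ˡ l)))
      + sumF (λ b′ → indicator (disjUnion (complete k) H (k ↑ʳ b) (k ↑ʳ b′)))
      ≡⟨ cong₂ _+_ (sumF-zero (cong indicator ∘ disjUnion-↑ʳ-↑ˡ (complete k) H b))
                   (sumF-cong (cong indicator ∘ disjUnion-↑ʳ-↑ʳ (complete k) H b)) ⟩
    sumF (indicator ∘ H b)
      ≡⟨ countF≡sumF (H b) ⟨
    countF (H b) ∎)
    where open ≡-Reasoning

  vol-apex-and-right : (S : VSet (suc (k + l))) → S zero ≡ true →
    (∀ a → S (suc (a ↑ˡ l)) ≡ false) → (∀ b → S (suc (k ↑ʳ b)) ≡ true) →
    vol B S ≡ k + l + (l + vol H full)
  vol-apex-and-right S apex left right = begin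
    vol B S
      ≡⟨ cong₂ _+_ (cong (if_then deg B zero else 0) apex) (sumF-↑ k (λ t → if S (suc t) then deg B (suc t) else 0)) ⟩
    deg B zero + (sumF (λ a → if S (suc (a ↑ˡ l)) then deg B (suc (a ↑ˡ l)) else 0)
                 + sumF (λ b → if S (suc (k ↑ʳ b)) then deg B (suc (k ↑ʳ b)) else 0))
      ≡⟨ cong₂ _+_ deg-apex (cong₂ _+_ (sumF-zero (λ a → cong (if_then deg B (suc (a ↑ˡ l)) else 0) (left a)))
                                       (sumF-cong (λ b → trans (cong (if_then deg B (suc (k ↑ʳ b)) else 0) (right b)) (deg-right b)))) ⟩
    k + l + sumF (λ b → 1 + deg H b)
      ≡⟨ cong (k + l +_) (trans (sumF-distrib-+ (λ _ → 1) (deg H))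
                                (cong (_+ vol H full) (trans (sumF-const {l} 1 (λ _ → refl)) (*-identityʳ l)))) ⟩
    k + l + (l + vol H full) ∎
    where open ≡-Reasoning

Isomorphic-cong : ∀ {m} {A : Adj n} {B B′ : Adj m} → Isomorphic A B → (∀ i j → B i j ≡ B′ i j) →
  Isomorphic A B′
Isomorphic-cong (f , adjacency) B≗B′ = f , λ i j → trans (sym (B≗B′ _ _)) (adjacency i j)

cone-congʳ : ∀ {m} {H H′ : Adj m} → (∀ i j → H i j ≡ H′ i j) → ∀ i j → cone H i j ≡ cone H′ i j
cone-congʳ H≗H′ zero    zero    = refl
cone-congʳ H≗H′ zero    (suc j) = refl
cone-congʳ H≗H′ (suc i) zero    = refl
cone-congʳ H≗H′ (suc i) (suc j) = H≗H′ i j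

disjUnion-congʳ : ∀ {k l} (K : Adj k) {H H′ : Adj l} → (∀ i j → H i j ≡ H′ i j) →
  ∀ i j → disjUnion K H i j ≡ disjUnion K H′ i j
disjUnion-congʳ {k} K H≗H′ i j with splitAt k i | splitAt k j
... | inj₁ _ | inj₁ _ = refl
... | inj₁ _ | inj₂ _ = refl
... | inj₂ _ | inj₁ _ = refl
... | inj₂ x | inj₂ y = H≗H′ x y

module ConeDecomposition {m : ℕ} {A : Adj (suc m)} (simple : Simple A)
  {w : Fin (suc m)} (dominating : Dominating A w) (P : VSet (suc m)) (Pw : P w ≡ false)
  (clique : Clique A P) (attached : ∀ u v → P u ≡ true → P v ≡ false → v ≢ w → A u v ≡ false) where

  private
    P′ : VSet m
    P′ = P ∘ punchIn w

  k l : ℕ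
  k = countF P′
  l = countF (not ∘ P′)

  -- Vertex 0 of the model is w; the others are the vertices ≠ w, reached via punchIn w, with P first.
  labelling : Fin (suc (k + l)) ↔ Fin (suc m)
  labelling = insert zero w (↔-trans +↔⊎ (partition P′))

  private
    label = Inverse.to labelling

  rest : Fin l → Fin (suc m)
  rest b = label (suc (k ↑ʳ b))

  label-left : ∀ a → label (suc (a ↑ˡ l)) ≡ punchIn w (merge P′ (inj₁ a))
  label-left a = cong (punchIn w ∘ merge P′) (splitAt-↑ˡ k a l)

  label-right : ∀ b → rest b ≡ punchIn w (merge P′ (inj₂ b))
  label-right b = cong (punchIn w ∘ merge P′) (splitAt-↑ʳ k l b)

  P-left : ∀ a → P (label (suc (a ↑ˡ l))) ≡ true
  P-left a = trans (cong P (label-left a)) (merge-inj₁ P′ a)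

  P-rest : ∀ b → P (rest b) ≡ false
  P-rest b = trans (cong P (label-right b)) (merge-inj₂ P′ b)

  label≢w : ∀ t → label (suc t) ≢ w
  label≢w t = punchInᵢ≢i w _

  H : Adj l
  H = induced A rest

  private
    B : Adj (suc (k + l))
    B = cone (disjUnion (complete k) H)

    left-adjacency : ∀ a a′ → A (label (suc (a ↑ˡ l))) (label (suc (a′ ↑ˡ l))) ≡ complete k a a′
    left-adjacency a a′ with a ≟ a′
    ... | yes refl = Simple.irrefl simple _
    ... | no a≢a′  = clique _ _ (P-left a) (P-left a′)
                       (a≢a′ ∘ ↑ˡ-injective l a a′ ∘ Fin.suc-injective ∘ injective-↔ labelling)

    left-rest-adjacency : ∀ a b → A (label (suc (a ↑ˡ l))) (rest b) ≡ false
    left-rest-adjacency a b = attached _ _ (P-left a) (P-rest b) (label≢w _)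

    joined-adjacency : ∀ x y → A (label (suc (join k l x))) (label (suc (join k l y)))
                             ≡ disjUnion (complete k) H (join k l x) (join k l y)
    joined-adjacency (inj₁ a) (inj₁ a′) =
      trans (left-adjacency a a′) (sym (disjUnion-↑ˡ-↑ˡ (complete k) H a a′))
    joined-adjacency (inj₁ a) (inj₂ b)  =
      trans (left-rest-adjacency a b) (sym (disjUnion-↑ˡ-↑ʳ (complete k) H a b))
    joined-adjacency (inj₂ b) (inj₁ a)  =
      trans (Simple.symm simple _ _) (trans (left-rest-adjacency a b) (sym (disjUnion-↑ʳ-↑ˡ (complete k) H b a)))
    joined-adjacency (inj₂ b) (inj₂ b′) = sym (disjUnion-↑ʳ-↑ʳ (complete k) H b b′)

  label-adjacency : ∀ t s → A (label t) (label s) ≡ B t s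
  label-adjacency zero    zero    = Simple.irrefl simple w
  label-adjacency zero    (suc s) = dominating _ (label≢w s)
  label-adjacency (suc t) zero    = trans (Simple.symm simple _ w) (dominating _ (label≢w t))
  label-adjacency (suc t) (suc s) =
    subst₂ (λ t s → A (label (suc t)) (label (suc s)) ≡ disjUnion (complete k) H t s)
      (join-splitAt k l t) (join-splitAt k l s) (joined-adjacency (splitAt k t) (splitAt k s))

  isomorphic : Isomorphic A (cone (disjUnion (complete k) H))
  isomorphic = Isomorphic-of-labelling {A = A} labelling label-adjacency

  rest-injective : ∀ {b b′} → rest b ≡ rest b′ → b ≡ b′
  rest-injective = ↑ʳ-injective k _ _ ∘ Fin.suc-injective ∘ injective-↔ labelling

  vol-outside : vol A (compl P) ≡ k + l + (l + vol H full)
  vol-outside = trans (vol-labelled {A = A} labelling label-adjacency (compl P))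
    (vol-apex-and-right k H (compl P ∘ label) (cong not Pw) (cong not ∘ P-left) (cong not ∘ P-rest))

  size-P : countF P ≡ k
  size-P = trans (countF-remove P w) (cong (λ b → indicator b + k) Pw)

  size-outside : countF (compl P) ≡ suc l
  size-outside = trans (countF-remove (compl P) w) (cong (λ b → indicator (not b) + l) Pw)

-- Sets of small Cheeger ratio

record SmallRatioSet (A : Adj n) (k : ℕ) (Y : VSet n) : Set where
  field
    nonempty      : 1 ≤ countF Y
    not-larger    : countF Y ≤ countF (compl Y)
    inside-large  : k * boundary A Y ≤ vol A Y
    outside-large : k * boundary A Y ≤ vol A (compl Y)

record Tight (A : Adj n) (k : ℕ) (P : VSet n) : Set where
  field
    size          : countF P ≡ k
    boundary≡     : boundary A P ≡ k
    inside-large  : k * k ≤ vol A P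
    outside-large : k * k ≤ vol A (compl P)

small-ratio-set : {A : Adj n} → Simple A → ∀ {k} → 0 < k → IsCheegerConstant A (ratio 1 k) →
  ∃ (SmallRatioSet A k)
small-ratio-set {A = A} simple {k} k>0 ((X , (inside , outside , den>0) , ratio≡) , _)
  with countF X ≤? countF (compl X)
... | yes X≤X̄ = X , record
  { nonempty      = countF-positive X (proj₁ inside) (proj₂ inside)
  ; not-larger    = X≤X̄
  ; inside-large  = ≤-trans (≤-reflexive (sym den≡)) (m⊓n≤m _ _)
  ; outside-large = ≤-trans (≤-reflexive (sym den≡)) (m⊓n≤n _ _)
  }
  where den≡ = ratio≡1/k⇒d≡k*b _ _ k den>0 k>0 ratio≡
... | no X≰X̄ = compl X , record
  { nonempty      = countF-positive (compl X) (proj₁ outside) (cong not (proj₂ outside))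
  ; not-larger    = ≤-trans (<⇒≤ (≰⇒> X≰X̄)) (≤-reflexive (sym (countF-cong (compl-compl X))))
  ; inside-large  = ≤-trans (≤-reflexive (trans (cong (k *_) ∂X̄≡∂X) (sym den≡))) (m⊓n≤n _ _)
  ; outside-large = ≤-trans (≤-reflexive (trans (cong (k *_) ∂X̄≡∂X) (sym den≡)))
                            (≤-trans (m⊓n≤m _ _) (≤-reflexive (sym (vol-cong A (compl-compl X)))))
  }
  where
  den≡ = ratio≡1/k⇒d≡k*b _ _ k den>0 k>0 ratio≡
  ∂X̄≡∂X = boundary-compl A X (Simple.symm simple)

module _ {A : Adj n} (simple : Simple A) {k : ℕ} where

  tight-clique : {P : VSet n} → Tight A k P → Clique A P
  tight-clique {P} tight = clique-of-volume simple P size (≤-reflexive boundary≡) inside-large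
    where open Tight tight

  tight-compl : {P : VSet n} → Tight A k P → countF (compl P) ≡ k → Tight A k (compl P)
  tight-compl {P} tight size′ = record
    { size          = size′
    ; boundary≡     = trans (boundary-compl A P (Simple.symm simple)) boundary≡
    ; inside-large  = outside-large
    ; outside-large = ≤-trans inside-large (≤-reflexive (sym (vol-cong A (compl-compl P))))
    }
    where open Tight tight

module _ {G : Adj n} (simple : Simple G) (disconnected : Disconnected G) where

  private
    C : Adj n
    C = complement G

  small-ratio⇒tight : ∀ {k Y} → 2 ≤ k → countF Y ≤ k → SmallRatioSet C k Y → Tight C k Y
  small-ratio⇒tight {k} {Y} k≥2 Y≤k small = record
    { size          = #Y≡k
    ; boundary≡     = ∂Y≡k
    ; inside-large  = ≤-trans (≤-reflexive (cong (k *_) (sym ∂Y≡k))) inside-large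
    ; outside-large = ≤-trans (≤-reflexive (cong (k *_) (sym ∂Y≡k))) outside-large
    }
    where
    open SmallRatioSet small
    Y≤∂Y : countF Y ≤ boundary C Y
    Y≤∂Y = ≤-trans (≤-reflexive (sym (m≤n⇒m⊓n≡m not-larger))) (boundary-of-complement≥ simple disconnected Y)
    k∂≤ : k * boundary C Y ≤ countF Y * (countF Y ∸ 1) + boundary C Y
    k∂≤ = ≤-trans inside-large (≤-trans (≤-reflexive (vol≡internalVol+boundary C Y))
            (+-monoˡ-≤ _ (internalVol≤ (complement-simple simple) Y)))
    #Y≡k = proj₁ (k*d≤m*[m∸1]+d⇒m≡k×d≡k _ _ _ nonempty k≥2 Y≤k Y≤∂Y k∂≤)
    ∂Y≡k = proj₂ (k*d≤m*[m∸1]+d⇒m≡k×d≡k _ _ _ nonempty k≥2 Y≤k Y≤∂Y k∂≤)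

  dominating-of-separation : (S : VSet n) → Separated G S → (∃ λ s → S s ≡ true) → (∃ λ s → S s ≡ false) →
    5 ≤ n → (Y : VSet n) → 1 ≤ countF Y → countF Y ≤ countF (compl Y) → boundary C Y ≤ countF Y →
    ∃ (Dominating C)
  dominating-of-separation S separated (s , Ss) (s̄ , Ss̄) n≥5 Y Y≥1 Y≤Ȳ ∂Y≤Y =
    [ singleton-joined⇒dominating joined ∘ trans #S
    , singleton-joined⇒dominating joined̄ ∘ trans #S̄ ]′ side
    where
    a b c d : ℕ
    a = countF (λ u → Y u ∧ S u)
    b = countF (λ u → Y u ∧ not (S u))
    c = countF (λ u → not (Y u) ∧ S u)
    d = countF (λ u → not (Y u) ∧ not (S u))
    joined : CompletelyJoined C S
    joined = separated⇒joined-in-complement separated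
    joined̄ : CompletelyJoined C (compl S)
    joined̄ = separated⇒joined-in-complement (separated-compl (Simple.symm simple) separated)
    #Y : countF Y ≡ a + b
    #Y = countF-split Y S
    #Ȳ : countF (compl Y) ≡ c + d
    #Ȳ = countF-split (compl Y) S
    #S : countF S ≡ a + c
    #S = trans (countF-split S Y) (cong₂ _+_ (countF-cong (λ u → Bool.∧-comm (S u) (Y u)))
                                             (countF-cong (λ u → Bool.∧-comm (S u) (not (Y u)))))
    #S̄ : countF (compl S) ≡ b + d
    #S̄ = trans (countF-split (compl S) Y) (cong₂ _+_ (countF-cong (λ u → Bool.∧-comm (not (S u)) (Y u)))
                                                     (countF-cong (λ u → Bool.∧-comm (not (S u)) (not (Y u)))))
    side : a + c ≡ 1 ⊎ b + d ≡ 1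
    side = a*d+b*c≤a+b⇒a+c≡1⊎b+d≡1 a b c d (≤-trans Y≥1 (≤-reflexive #Y)) (subst₂ _≤_ #Y #Ȳ Y≤Ȳ)
      (≤-trans n≥5 (≤-reflexive (trans (sym (countF+countF-not Y)) (cong₂ _+_ #Y #Ȳ))))
      (≤-trans (boundary≥cross-products (complement-simple simple) joined Y) (≤-trans ∂Y≤Y (≤-reflexive #Y)))
      (≤-trans (countF-positive S s Ss) (≤-reflexive #S))
      (≤-trans (countF-positive (compl S) s̄ (cong not Ss̄)) (≤-reflexive #S̄))

  dominating-vertex : Fin n → 5 ≤ n → (Y : VSet n) → 1 ≤ countF Y → countF Y ≤ countF (compl Y) →
    boundary C Y ≤ countF Y → ∃ (Dominating C)
  dominating-vertex v₀ =
    let S , inside , outside , separated = disconnected⇒separated G (Simple.symm simple) disconnected v₀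
    in dominating-of-separation S separated inside outside

module _ {n : ℕ} {A : Adj n} (simple : Simple A) {k : ℕ} {P : VSet n} (tight : Tight A k P) where

  tight-avoiding : ∀ {w} → Dominating A w → countF P ≤ countF (compl P) →
    Σ (VSet n) λ Q → Tight A k Q × Q w ≡ false
  tight-avoiding {w} dominating P≤P̄ with P w in Pw
  ... | false = P , tight , Pw
  ... | true  = compl P , tight-compl simple tight (≤-antisym P̄≤k k≤P̄) , cong not Pw
    where
    open Tight tight
    P̄≤k = ≤-trans (dominating-inside⇒boundary≥ dominating P Pw) (≤-reflexive boundary≡)
    k≤P̄ = ≤-trans (≤-reflexive (sym size)) P≤P̄

module _ {m : ℕ} {A : Adj (suc m)} (simple : Simple A) {k : ℕ} {P : VSet (suc m)} (tight : Tight A k P)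
         {w : Fin (suc m)} (dominating : Dominating A w) (Pw : P w ≡ false) where

  private
    open Tight tight
    module D = ConeDecomposition simple dominating P Pw (tight-clique simple tight)
                 (dominating-absorbs-boundary simple dominating P Pw (≤-reflexive (trans boundary≡ (sym size))))

    D-k≡k : D.k ≡ k
    D-k≡k = trans (sym D.size-P) size

  cone-over-two-cliques : countF (compl P) ≡ k → Isomorphic A (cone (disjUnion (complete k) (complete (k ∸ 1))))
  cone-over-two-cliques P̄≡k =
    subst₂ (λ a b → Isomorphic A (cone (disjUnion (complete a) (complete b)))) D-k≡k D-l≡k∸1
      (Isomorphic-cong D.isomorphic (cone-congʳ (disjUnion-congʳ (complete D.k) H-complete)))
    where
    D-l≡k∸1 : D.l ≡ k ∸ 1
    D-l≡k∸1 = cong (_∸ 1) (trans (sym D.size-outside) P̄≡k)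
    outside-clique : Clique A (compl P)
    outside-clique = tight-clique simple (tight-compl simple tight P̄≡k)
    H-complete : ∀ b b′ → D.H b b′ ≡ complete D.l b b′
    H-complete b b′ with b ≟ b′
    ... | yes refl = Simple.irrefl simple _
    ... | no b≢b′  = outside-clique _ _ (cong not (D.P-rest b)) (cong not (D.P-rest b′))
                                    (λ e → b≢b′ (D.rest-injective e))

  cone-over-clique-and-dense : countF (compl P) ≡ suc k →
    Σ (Adj k) λ H → Simple H × (k * (k ∸ 3) ≤ vol H full) × Isomorphic A (cone (disjUnion (complete k) H))
  cone-over-clique-and-dense P̄≡k+1 =
    subst₂ (λ a b → Σ (Adj b) λ H → Simple H × (b * (b ∸ 3) ≤ vol H full) ×
                                    Isomorphic A (cone (disjUnion (complete a) H)))
      D-k≡k D-l≡k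
      (D.H , induced-simple simple D.rest , dense , D.isomorphic)
    where
    D-l≡k : D.l ≡ k
    D-l≡k = suc-injective (trans (sym D.size-outside) P̄≡k+1)
    dense : D.l * (D.l ∸ 3) ≤ vol D.H full
    dense = k*k≤3k+v⇒k*[k∸3]≤v D.l (vol D.H full)
      (subst₂ (λ x y → x * x ≤ y + D.l + (D.l + vol D.H full)) (sym D-l≡k) (trans D-k≡k (sym D-l≡k))
        (≤-trans outside-large (≤-reflexive D.vol-outside)))

countF-compl-half : (P : VSet n) → countF P ≡ n / 2 → countF (compl P) ≡ n % 2 + n / 2
countF-compl-half {n} P #P≡k = m+x≡r+m*2⇒x≡r+m (n / 2) (countF (compl P)) (n % 2)
  (trans (cong (_+ countF (compl P)) (sym #P≡k)) (trans (countF+countF-not P) (m≡m%n+[m/n]*n n 2)))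

module _ {n : ℕ} (n≥5 : 5 ≤ n) {G : Adj n} (simple : Simple G) (disconnected : Disconnected G)
         (cheeger : IsCheegerConstant (complement G) (ratio 1 (n / 2))) where

  private
    C : Adj n
    C = complement G
    k : ℕ
    k = n / 2
    k≥2 : 2 ≤ k
    k≥2 = /-monoˡ-≤ 2 (≤-trans (s≤s (s≤s (s≤s (s≤s z≤n)))) n≥5)

  dominating-vertex-and-tight-set : Σ (Fin n) λ w → Dominating C w × Σ (VSet n) λ P → Tight C k P × P w ≡ false
  dominating-vertex-and-tight-set =
    let Y , small    = small-ratio-set (complement-simple simple) (≤-trans (s≤s z≤n) k≥2) cheeger
        open SmallRatioSet small
        tight         = small-ratio⇒tight simple disconnected k≥2 (Y≤k Y not-larger) small
        open Tight tight
        w , dominating = dominating-vertex simple disconnected (proj₁ (countF-witness Y nonempty)) n≥5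
                           Y nonempty not-larger (≤-reflexive (trans boundary≡ (sym size)))
    in w , dominating , tight-avoiding (complement-simple simple) tight dominating not-larger
    where
    Y≤k : ∀ Y → countF Y ≤ countF (compl Y) → countF Y ≤ k
    Y≤k Y Y≤Ȳ = ≤-trans (≤-half _ _ Y≤Ȳ) (≤-reflexive (cong (_/ 2) (countF+countF-not Y)))

theorem4p3 : (n : ℕ) → 5 ≤ n → (G : Adj n) → Simple G → Disconnected G →
    IsCheegerConstant (complement G) (ratio 1 (n / 2)) →
    (n % 2 ≡ 0 →
      Isomorphic (complement G) (cone (disjUnion (complete (n / 2)) (complete (n / 2 ∸ 1))))) ×
    (n % 2 ≡ 1 →
      Σ (Adj ((n ∸ 1) / 2)) λ H → Simple H ×
        ((n ∸ 1) / 2 * ((n ∸ 1) / 2 ∸ 3) ≤ vol H full) ×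
        Isomorphic (complement G) (cone (disjUnion (complete ((n ∸ 1) / 2)) H)))
theorem4p3 (suc m) n≥5 G simple disconnected cheeger =
  let w , dominating , P , tight , Pw = dominating-vertex-and-tight-set n≥5 simple disconnected cheeger
      C-simple = complement-simple simple
      P̄-size   = countF-compl-half P (Tight.size tight)
  in (λ even → cone-over-two-cliques C-simple tight dominating Pw (trans P̄-size (cong (_+ suc m / 2) even)))
   , (λ odd → subst (λ a → Σ (Adj a) λ H → Simple H × (a * (a ∸ 3) ≤ vol H full) ×
                                     Isomorphic (complement G) (cone (disjUnion (complete a) H)))
                    (sym (odd-half (suc m) odd))
                    (cone-over-clique-and-dense C-simple tight dominating Pw (trans P̄-size (cong (_+ suc m / 2) odd))))
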